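{- Let $N,M$ be coprime positive integers, $R$ a ring and $V$ an $R$-module with a left $\mathrm{Mat}_2(\mathbb{Z})_{\neq0}$-action. The homomorphism $$\mathcal{W}(M,V)\to\mathrm{Hom}_{R[\Gamma_1(NM)]}(R[\Gamma_1(N)],V),\qquad f\mapsto\big(g\mapsto(g.f)((0,1))\big)$$ is an isomorphism of left $\Gamma_1(N)$-modules (for the restricted action on $\mathcal{W}(M,V)$). In particular, $\mathcal{W}(M,V)\cong\mathrm{Coind}_{\Gamma_1(NM)}^{\Gamma_1(N)}(V)$ as left $\Gamma_1(N)$-modules.
   Context: $\mathrm{Mat}_2(\mathbb{Z})_{\neq0}$ is the semigroup of integer $2\times2$ matrices with nonzero determinant. $\mathcal{W}(M,V)=\{f\in\mathrm{Hom}_R(R[(\mathbb{Z}/M\mathbb{Z})^2],V): f((u,v))=0$ whenever $\langle u,v\rangle\ne\mathbb{Z}/M\mathbb{Z}\}$ with left action $(g.f)((u,v))=g.f((u,v)g)$ (row vector times $g$ mod $M$). The coinduced module $\mathrm{Hom}_{R[\Gamma_1(NM)]}(R[\Gamma_1(N)],V)$ has left $\Gamma_1(N)$-action $(h.\varphi)(g)=\varphi(gh)$. -}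

module Defs where

open import Level using (Level; _⊔_)
open import Data.Nat as ℕ using (ℕ)
open import Data.Integer as ℤ using (ℤ; +_; _+_; _*_; _-_; 0ℤ; 1ℤ)
open import Data.Integer.Divisibility using (_∣_)
open import Data.Integer.DivMod using (_%ℕ_; n%ℕd<d)
open import Data.Fin using (Fin; toℕ; fromℕ<)
open import Data.Product using (_×_; _,_; ∃₂)
open import Relation.Binary.PropositionalEquality using (_≡_; _≢_; sym; trans)
open import Relation.Nullary using (¬_)
open import Algebra.Bundles using (Ring)
open import Algebra.Module.Bundles using (LeftModule)

record Mat : Set where
  constructor mat
  field
    a b c d : ℤ

infixl 7 _·_
_·_ : Mat → Mat → Mat
mat a b c d · mat a' b' c' d' =
  mat (a * a' + b * c') (a * b' + b * d') (c * a' + d * c') (c * b' + d * d')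

I₂ : Mat
I₂ = mat 1ℤ 0ℤ 0ℤ 1ℤ

det : Mat → ℤ
det (mat a b c d) = a * d - b * c

record Γ₁ (N : ℕ) (g : Mat) : Set where
  field
    det≡1 : det g ≡ 1ℤ
    a≡1   : + N ∣ (Mat.a g - 1ℤ)
    c≡0   : + N ∣ Mat.c g
    d≡1   : + N ∣ (Mat.d g - 1ℤ)

Γ₁⇒det≢0 : ∀ {N g} → Γ₁ N g → det g ≢ 0ℤ
Γ₁⇒det≢0 p eq with trans (sym (Γ₁.det≡1 p)) eq
... | ()

-- (ℤ/Mℤ)² as Fin M × Fin M, with row-vector-times-matrix mod M

reduce : (M : ℕ) .{{_ : ℕ.NonZero M}} → ℤ → Fin M
reduce M z = fromℕ< (n%ℕd<d z M)

Pair : ℕ → Set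
Pair M = Fin M × Fin M

rowMul : (M : ℕ) .{{_ : ℕ.NonZero M}} → Pair M → Mat → Pair M
rowMul M (u , v) (mat a b c d) =
  reduce M (+ toℕ u * a + + toℕ v * c) , reduce M (+ toℕ u * b + + toℕ v * d)

e₂ : (M : ℕ) .{{_ : ℕ.NonZero M}} → Pair M
e₂ M = reduce M 0ℤ , reduce M 1ℤ

-- ⟨u , v⟩ = ℤ/Mℤ  (the subgroup generated by u and v contains 1)
Generates : (M : ℕ) → Pair M → Set
Generates M (u , v) = ∃₂ λ x y → + M ∣ (x * + toℕ u + y * + toℕ v - 1ℤ)

record MatAction {r ℓr m ℓm : Level} (R : Ring r ℓr) (V : LeftModule R m ℓm)
       : Set (r ⊔ ℓr ⊔ m ⊔ ℓm) where
  open Ring R using () renaming (Carrier to R₀)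
  open LeftModule V
  field
    act    : (g : Mat) → .(det g ≢ 0ℤ) → Carrierᴹ → Carrierᴹ
    act-cong : ∀ g .(p : det g ≢ 0ℤ) {x y} → x ≈ᴹ y → act g p x ≈ᴹ act g p y
    act-+  : ∀ g .(p : det g ≢ 0ℤ) x y → act g p (x +ᴹ y) ≈ᴹ act g p x +ᴹ act g p y
    act-*ₗ : ∀ g .(p : det g ≢ 0ℤ) (s : R₀) x → act g p (s *ₗ x) ≈ᴹ s *ₗ act g p x
    act-I  : ∀ .(p : det I₂ ≢ 0ℤ) x → act I₂ p x ≈ᴹ x
    act-·  : ∀ g h .(pg : det g ≢ 0ℤ) .(ph : det h ≢ 0ℤ) .(pgh : det (g · h) ≢ 0ℤ) x →
             act (g · h) pgh x ≈ᴹ act g pg (act h ph x)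

module Construction {r ℓr m ℓm : Level} {R : Ring r ℓr} {V : LeftModule R m ℓm}
                    (A : MatAction R V) (N M : ℕ) .{{_ : ℕ.NonZero M}} where
  open LeftModule V
  open MatAction A

  -- 𝒲(M,V): R-linear maps R[(ℤ/M)²] → V, i.e. maps on the basis (ℤ/M)²,
  -- vanishing on non-generating pairs.
  InW : (Pair M → Carrierᴹ) → Set (ℓm)
  InW f = ∀ x → ¬ Generates M x → f x ≈ᴹ 0ᴹ

  actW : (h : Mat) → .(Γ₁ N h) → (Pair M → Carrierᴹ) → (Pair M → Carrierᴹ)
  actW h ph f x = act h (Γ₁⇒det≢0 ph) (f (rowMul M x h))

  -- Coind: maps φ : Γ₁(N) → V (i.e. R-linear maps R[Γ₁(N)] → V on the basis)
  -- which are R[Γ₁(NM)]-linear: φ(k g) = k.φ(g).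
  Cochain : Set m
  Cochain = (g : Mat) → .(Γ₁ N g) → Carrierᴹ

  InCoind : Cochain → Set ℓm
  InCoind φ = ∀ k g .(pk : Γ₁ (N ℕ.* M) k) .(pg : Γ₁ N g) .(pkg : Γ₁ N (k · g)) →
              φ (k · g) pkg ≈ᴹ act k (Γ₁⇒det≢0 pk) (φ g pg)

  _≈C_ : Cochain → Cochain → Set ℓm
  φ ≈C ψ = ∀ g .(pg : Γ₁ N g) → φ g pg ≈ᴹ ψ g pg

  -- the map f ↦ (g ↦ (g.f)((0,1))) = (g ↦ g.f((0,1) g))
  Φ : (Pair M → Carrierᴹ) → Cochain
  Φ f g pg = act g (Γ₁⇒det≢0 pg) (f (rowMul M (e₂ M) g))

-- Φ f is determined by f on the Γ₁(N)-orbit of e₂ = (0,1), and everything rests on two facts about this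
-- orbit: it consists exactly of the generating pairs of (ℤ/M)², and g, g' ∈ Γ₁(N) give the same point iff
-- g' g⁻¹ ∈ Γ₁(NM).  For the first, the Chinese remainder theorem lifts a generating pair (u,v) to a row
-- (c₀,d₀) that is unimodular modulo NM and ≡ (0,1) modulo N; moving c₀ and d₀ within their classes modulo
-- NM makes them coprime integers, and a Bézout relation completes (c,d) to a matrix of SL₂(ℤ), which then
-- lies in Γ₁(N).  Hence f(x) = g⁻¹.Φf(g) for any g ∈ Γ₁(N) with e₂g = x, which gives injectivity since f
-- vanishes off generating pairs; conversely f(x) := g⁻¹.φ(g) does not depend on g since φ is
-- Γ₁(NM)-equivariant.

module Submission where

open import Defs
open import Level using (Level; 0ℓ)
open import Data.Nat.Base as ℕ using (ℕ; NonZero)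
import Data.Nat.Properties as ℕ
import Data.Nat.DivMod as ℕ
import Data.Nat.Divisibility as ℕ
open import Data.Nat.Induction using (<-rec)
open import Data.Nat.GCD using (gcd; gcd[m,n]∣m; gcd[m,n]∣n; gcd[m,n]≡0⇒m≡0; module Bézout)
open import Data.Nat.Coprimality using (Coprime; coprime?; coprime-Bézout; coprime-divisor; gcd≡1⇒coprime)
open import Data.Integer.Base using (ℤ; +_; _+_; _*_; -_; _-_; 0ℤ; 1ℤ; ∣_∣)
open import Data.Integer.Properties
  using (+-comm; +-identityʳ; +-inverseʳ; pos-+; pos-*; +-injective; i-j≡0⇒i≡j; ∣i∣≡0⇒i≡0
        ; m-n≡m⊖n; ∣m⊝n∣≤m⊔n)
import Data.Integer.Divisibility as ℤᵘ
open import Data.Integer.Divisibility.Signed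
  using (_∣_; divides; ∣ᵤ⇒∣; ∣⇒∣ᵤ; ∣-trans; ∣m⇒∣-m; ∣m∣n⇒∣m+n; ∣m∣n⇒∣m-n; ∣m⇒∣m*n; ∣n⇒∣m*n)
open import Data.Integer.DivMod using (_%ℕ_; _/ℕ_; a≡a%ℕn+[a/ℕn]*n)
open import Data.Integer.Tactic.RingSolver using (solve-∀)
open import Data.Fin.Base using (Fin; toℕ)
open import Data.Fin.Properties using (toℕ-injective; toℕ<n; toℕ-fromℕ<; any?; _≟_)
open import Data.Product using (Σ; ∃; ∃₂; _×_; _,_; proj₁; proj₂)
open import Data.Product.Properties using (≡-dec)
open import Data.Empty using (⊥-elim; ⊥-elim-irr)
open import Function.Base using (_∘_)
open import Relation.Nullary.Decidable using (Dec; yes; no; map′; recompute)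
open import Relation.Binary.Bundles using (Setoid)
open import Relation.Binary.Structures using (IsEquivalence)
open import Relation.Binary.PropositionalEquality
import Relation.Binary.Reasoning.Setoid as SetoidReasoning
open import Algebra.Bundles using (Ring)
open import Algebra.Module.Bundles using (LeftModule)

-- Congruences of integers modulo n

-- A record rather than a synonym for + n ∣ x - y, so that x and y can be inferred from a proof.
infix 4 _≡_mod_
record _≡_mod_ (x y : ℤ) (n : ℕ) : Set where
  constructor ∣⇒≡-mod
  field ≡-mod⇒∣ : + n ∣ x - y
open _≡_mod_ public

module _ {n : ℕ} where

  ≡-mod-refl : ∀ {x} → x ≡ x mod n
  ≡-mod-refl {x} = ∣⇒≡-mod (divides 0ℤ (+-inverseʳ x))

  ≡-mod-reflexive : ∀ {x y} → x ≡ y → x ≡ y mod n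
  ≡-mod-reflexive refl = ≡-mod-refl

  ≡-mod-sym : ∀ {x y} → x ≡ y mod n → y ≡ x mod n
  ≡-mod-sym {x} {y} (∣⇒≡-mod n∣x-y) = ∣⇒≡-mod (subst (+ n ∣_) (-[x-y]≡y-x x y) (∣m⇒∣-m n∣x-y))
    where
    -[x-y]≡y-x : ∀ x y → - (x - y) ≡ y - x
    -[x-y]≡y-x = solve-∀

  ≡-mod-trans : ∀ {x y z} → x ≡ y mod n → y ≡ z mod n → x ≡ z mod n
  ≡-mod-trans {x} {y} {z} (∣⇒≡-mod n∣x-y) (∣⇒≡-mod n∣y-z) =
    ∣⇒≡-mod (subst (+ n ∣_) (telescope x y z) (∣m∣n⇒∣m+n n∣x-y n∣y-z))
    where
    telescope : ∀ x y z → (x - y) + (y - z) ≡ x - z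
    telescope = solve-∀

  ≡-mod-isEquivalence : IsEquivalence (λ x y → x ≡ y mod n)
  ≡-mod-isEquivalence = record { refl = ≡-mod-refl ; sym = ≡-mod-sym ; trans = ≡-mod-trans }

  +-cong-mod : ∀ {x y u v} → x ≡ y mod n → u ≡ v mod n → x + u ≡ y + v mod n
  +-cong-mod {x} {y} {u} {v} (∣⇒≡-mod n∣x-y) (∣⇒≡-mod n∣u-v) =
    ∣⇒≡-mod (subst (+ n ∣_) (regroup x y u v) (∣m∣n⇒∣m+n n∣x-y n∣u-v))
    where
    regroup : ∀ x y u v → (x - y) + (u - v) ≡ (x + u) - (y + v)
    regroup = solve-∀

  *-cong-mod : ∀ {x y u v} → x ≡ y mod n → u ≡ v mod n → x * u ≡ y * v mod n
  *-cong-mod {x} {y} {u} {v} (∣⇒≡-mod n∣x-y) (∣⇒≡-mod n∣u-v) =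
    ∣⇒≡-mod (subst (+ n ∣_) (regroup x y u v) (∣m∣n⇒∣m+n (∣m⇒∣m*n u n∣x-y) (∣n⇒∣m*n y n∣u-v)))
    where
    regroup : ∀ x y u v → (x - y) * u + y * (u - v) ≡ x * u - y * v
    regroup = solve-∀

  *-congˡ-mod : ∀ k {x y} → x ≡ y mod n → k * x ≡ k * y mod n
  *-congˡ-mod k = *-cong-mod (≡-mod-refl {k})

  +-multiple-mod : ∀ x k → x + k * + n ≡ x mod n
  +-multiple-mod x k = ∣⇒≡-mod (divides k (x+kn-x≡kn x k (+ n)))
    where
    x+kn-x≡kn : ∀ x k n → x + k * n - x ≡ k * n
    x+kn-x≡kn = solve-∀

  multiple≡0-mod : ∀ k → k * + n ≡ 0ℤ mod n
  multiple≡0-mod k = ∣⇒≡-mod (divides k (+-identityʳ (k * + n)))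

≡-mod-setoid : ℕ → Setoid 0ℓ 0ℓ
≡-mod-setoid n = record { isEquivalence = ≡-mod-isEquivalence {n} }

module ≡-mod-Reasoning (n : ℕ) = SetoidReasoning (≡-mod-setoid n)

≡-mod-∣ : ∀ {m n x y} → m ℕ.∣ n → x ≡ y mod n → x ≡ y mod m
≡-mod-∣ m∣n (∣⇒≡-mod n∣x-y) = ∣⇒≡-mod (∣-trans (∣ᵤ⇒∣ m∣n) n∣x-y)

∣ᵤ⇒≡-mod : ∀ {n x y} → + n ℤᵘ.∣ x - y → x ≡ y mod n
∣ᵤ⇒≡-mod n∣x-y = ∣⇒≡-mod (∣ᵤ⇒∣ n∣x-y)

≡-mod⇒∣ᵤ : ∀ {n x y} → x ≡ y mod n → + n ℤᵘ.∣ x - y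
≡-mod⇒∣ᵤ x≡y = ∣⇒∣ᵤ (≡-mod⇒∣ x≡y)

∣ᵤ⇒≡0-mod : ∀ {n x} → + n ℤᵘ.∣ x → x ≡ 0ℤ mod n
∣ᵤ⇒≡0-mod {x = x} n∣x = ∣ᵤ⇒≡-mod (subst (+ _ ℤᵘ.∣_) (sym (+-identityʳ x)) n∣x)

≡0-mod⇒∣ᵤ : ∀ {n x} → x ≡ 0ℤ mod n → + n ℤᵘ.∣ x
≡0-mod⇒∣ᵤ {x = x} x≡0 = subst (+ _ ℤᵘ.∣_) (+-identityʳ x) (≡-mod⇒∣ᵤ x≡0)

≡-mod-resp-∣ : ∀ {k x y} → x ≡ y mod k → + k ∣ x → + k ∣ y
≡-mod-resp-∣ {k} {x} {y} (∣⇒≡-mod k∣x-y) k∣x = subst (+ k ∣_) (x-[x-y]≡y x y) (∣m∣n⇒∣m-n k∣x k∣x-y)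
  where
  x-[x-y]≡y : ∀ x y → x - (x - y) ≡ y
  x-[x-y]≡y = solve-∀

coprime-*-∣ : ∀ {m n k} → Coprime m n → m ℕ.∣ k → n ℕ.∣ k → m ℕ.* n ℕ.∣ k
coprime-*-∣ {m} {n} cop m∣k (ℕ.divides q refl) =
  ℕ.*-monoˡ-∣ n (coprime-divisor cop (subst (m ℕ.∣_) (ℕ.*-comm q n) m∣k))

≡-mod-* : ∀ {m n x y} → Coprime m n → x ≡ y mod m → x ≡ y mod n → x ≡ y mod m ℕ.* n
≡-mod-* cop x≡y[m] x≡y[n] = ∣ᵤ⇒≡-mod (coprime-*-∣ cop (≡-mod⇒∣ᵤ x≡y[m]) (≡-mod⇒∣ᵤ x≡y[n]))

%ℕ-≡-mod : ∀ n .{{_ : NonZero n}} x → + (x %ℕ n) ≡ x mod n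
%ℕ-≡-mod n x = ≡-mod-sym (∣⇒≡-mod (divides (x /ℕ n) (begin
  x - + (x %ℕ n)                             ≡⟨ cong (_- + (x %ℕ n)) (a≡a%ℕn+[a/ℕn]*n x n) ⟩
  + (x %ℕ n) + (x /ℕ n) * + n - + (x %ℕ n)   ≡⟨ r+qn-r≡qn (+ (x %ℕ n)) (x /ℕ n) (+ n) ⟩
  (x /ℕ n) * + n                             ∎)))
  where
  open ≡-Reasoning
  r+qn-r≡qn : ∀ r q n → r + q * n - r ≡ q * n
  r+qn-r≡qn = solve-∀

+-multiple-ℕ-mod : ∀ n r t → + (r ℕ.+ t ℕ.* n) ≡ + r mod n
+-multiple-ℕ-mod n r t = begin
  + (r ℕ.+ t ℕ.* n)  ≡⟨ trans (pos-+ r (t ℕ.* n)) (cong (λ z → + r + z) (pos-* t n)) ⟩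
  + r + + t * + n    ≈⟨ +-multiple-mod (+ r) (+ t) ⟩
  + r                ∎
  where open ≡-mod-Reasoning n

residue-unique : ∀ {n r s} → r ℕ.< n → s ℕ.< n → + r ≡ + s mod n → r ≡ s
residue-unique {n} {r} {s} r<n s<n r≡s = +-injective (i-j≡0⇒i≡j (+ r) (+ s) (∣i∣≡0⇒i≡0 ∣r-s∣≡0))
  where
  instance
    n≢0 : NonZero n
    n≢0 = ℕ.>-nonZero (ℕ.≤-<-trans ℕ.z≤n r<n)
  ∣r-s∣<n : ∣ + r - + s ∣ ℕ.< n
  ∣r-s∣<n = ℕ.≤-<-trans (ℕ.≤-reflexive (cong ∣_∣ (m-n≡m⊖n r s)))
              (ℕ.≤-<-trans (∣m⊝n∣≤m⊔n r s) (ℕ.⊔-pres-<m r<n s<n))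
  ∣r-s∣≡0 : ∣ + r - + s ∣ ≡ 0
  ∣r-s∣≡0 = trans (sym (ℕ.m<n⇒m%n≡m ∣r-s∣<n)) (ℕ.n∣m⇒m%n≡0 _ n (≡-mod⇒∣ᵤ r≡s))

-- Bézout and the Chinese remainder theorem

private
  cast-Bézout : ∀ {a b m n} → 1 ℕ.+ b ℕ.* n ≡ a ℕ.* m → + a * + m + - + b * + n ≡ 1ℤ
  cast-Bézout {a} {b} {m} {n} eq = begin
    + a * + m + - + b * + n           ≡⟨ cong (_+ - + b * + n) (trans (sym (pos-* a m)) (cong +_ (sym eq))) ⟩
    + (1 ℕ.+ b ℕ.* n) + - + b * + n   ≡⟨ cong (_+ - + b * + n) (trans (pos-+ 1 (b ℕ.* n))
                                                                     (cong (λ z → 1ℤ + z) (pos-* b n))) ⟩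
    1ℤ + + b * + n + - + b * + n      ≡⟨ cancel (+ b) (+ n) ⟩
    1ℤ                                ∎
    where
    open ≡-Reasoning
    cancel : ∀ b n → 1ℤ + b * n + - b * n ≡ 1ℤ
    cancel = solve-∀

bézout-ℤ : ∀ {m n} → Coprime m n → ∃₂ λ p q → p * + m + q * + n ≡ 1ℤ
bézout-ℤ c with coprime-Bézout c
... | Bézout.+- x y eq = + x , - + y , cast-Bézout {x} {y} eq
... | Bézout.-+ x y eq = - + x , + y , trans (+-comm (- + x * + _) (+ y * + _)) (cast-Bézout {y} {x} eq)

bézout-idempotent : ∀ {m n p q} → p * + m + q * + n ≡ 1ℤ → q * + n ≡ 1ℤ mod m
bézout-idempotent {m} {n} {p} {q} pm+qn≡1 = begin
  q * + n              ≈⟨ ≡-mod-sym (+-multiple-mod (q * + n) p) ⟩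
  q * + n + p * + m    ≡⟨ +-comm (q * + n) (p * + m) ⟩
  p * + m + q * + n    ≡⟨ pm+qn≡1 ⟩
  1ℤ                   ∎
  where open ≡-mod-Reasoning m

-- Existence lemmas that are destructured with `with` later on are opaque: otherwise Agda unfolds the whole
-- construction of the witness, which exhausts memory.
opaque
  crt : ∀ {m n} → Coprime m n → ∀ a b → ∃ λ z → (z ≡ a mod m) × (z ≡ b mod n)
  crt {m} {n} cop a b with bézout-ℤ cop
  ... | p , q , pm+qn≡1 = a * (q * + n) + b * (p * + m) , ≡a , ≡b
    where
    ≡a : a * (q * + n) + b * (p * + m) ≡ a mod m
    ≡a = begin
      a * (q * + n) + b * (p * + m)  ≈⟨ +-cong-mod (*-congˡ-mod a (bézout-idempotent {m} {n} {p} {q} pm+qn≡1))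
                                                   (*-congˡ-mod b (multiple≡0-mod p)) ⟩
      a * 1ℤ + b * 0ℤ                ≡⟨ a*1+b*0≡a a b ⟩
      a                              ∎
      where
      open ≡-mod-Reasoning m
      a*1+b*0≡a : ∀ a b → a * 1ℤ + b * 0ℤ ≡ a
      a*1+b*0≡a = solve-∀
    ≡b : a * (q * + n) + b * (p * + m) ≡ b mod n
    ≡b = begin
      a * (q * + n) + b * (p * + m)  ≈⟨ +-cong-mod (*-congˡ-mod a (multiple≡0-mod q))
                                                   (*-congˡ-mod b (bézout-idempotent {n} {m} {q} {p} qn+pm≡1)) ⟩
      a * 0ℤ + b * 1ℤ                ≡⟨ a*0+b*1≡b a b ⟩
      b                              ∎
      where
      open ≡-mod-Reasoning n
      a*0+b*1≡b : ∀ a b → a * 0ℤ + b * 1ℤ ≡ b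
      a*0+b*1≡b = solve-∀
      qn+pm≡1 : q * + n + p * + m ≡ 1ℤ
      qn+pm≡1 = trans (+-comm (q * + n) (p * + m)) pm+qn≡1

-- Coprime values of an arithmetic progression

CoprimeSplit : ℕ → ℕ → Set
CoprimeSplit D C = ∃₂ λ A B → C ≡ A ℕ.* B × Coprime A D × ∃ λ k → B ℕ.∣ D ℕ.^ k

coprime-split : ∀ D C → .{{NonZero C}} → CoprimeSplit D C
coprime-split D = <-rec (λ C → .{{NonZero C}} → CoprimeSplit D C) split
  where
  split : ∀ C → (∀ {C'} → C' ℕ.< C → .{{NonZero C'}} → CoprimeSplit D C') → .{{NonZero C}} → CoprimeSplit D C
  split C rec with coprime? C D | gcd[m,n]∣m C D
  ... | yes C⊥D | _ = C , 1 , sym (ℕ.*-identityʳ C) , C⊥D , 0 , ℕ.∣-refl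
  ... | no ¬C⊥D | ℕ.divides C' C≡C'g with rec C'<C {{C'≢0}}
    where
    g : ℕ
    g = gcd C D
    C'≢0 : NonZero C'
    C'≢0 = ℕ.≢-nonZero λ C'≡0 → ℕ.≢-nonZero⁻¹ C (trans C≡C'g (cong (ℕ._* g) C'≡0))
    1<g : 1 ℕ.< g
    1<g = ℕ.≤∧≢⇒< (ℕ.n≢0⇒n>0 (λ g≡0 → ℕ.≢-nonZero⁻¹ C (gcd[m,n]≡0⇒m≡0 g≡0))) (λ 1≡g → ¬C⊥D (gcd≡1⇒coprime (sym 1≡g)))
    C'<C : C' ℕ.< C
    C'<C = subst (C' ℕ.<_) (sym C≡C'g) (ℕ.m<m*n C' g {{C'≢0}} 1<g)
  ... | A , B , C'≡AB , A⊥D , k , B∣Dᵏ =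
    A , gcd C D ℕ.* B , C≡A[gB] , A⊥D , ℕ.suc k , ℕ.*-pres-∣ (gcd[m,n]∣n C D) B∣Dᵏ
    where
    open ≡-Reasoning
    C≡A[gB] : C ≡ A ℕ.* (gcd C D ℕ.* B)
    C≡A[gB] = begin
      C                      ≡⟨ C≡C'g ⟩
      C' ℕ.* gcd C D         ≡⟨ cong (ℕ._* gcd C D) C'≡AB ⟩
      A ℕ.* B ℕ.* gcd C D    ≡⟨ ℕ.*-assoc A B (gcd C D) ⟩
      A ℕ.* (B ℕ.* gcd C D)  ≡⟨ cong (A ℕ.*_) (ℕ.*-comm B (gcd C D)) ⟩
      A ℕ.* (gcd C D ℕ.* B)  ∎

coprime-∣^⇒≡1 : ∀ {e D} k → Coprime e D → e ℕ.∣ D ℕ.^ k → e ≡ 1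
coprime-∣^⇒≡1 ℕ.zero    _   e∣1    = ℕ.∣1⇒≡1 e∣1
coprime-∣^⇒≡1 (ℕ.suc k) e⊥D e∣DDᵏ = coprime-∣^⇒≡1 k e⊥D (coprime-divisor e⊥D e∣DDᵏ)

-- t = A where C = A B with A ⊥ D and B ∣ Dᵏ: a common divisor of C and D + A L is prime to A, so it
-- divides B; and it is prime to D, since a common factor of it and D divides A L but is prime to A, hence
-- divides L.
coprime-progression : ∀ C D L → .{{NonZero C}} →
                      (∀ {e} → e ℕ.∣ C → e ℕ.∣ D → e ℕ.∣ L → e ≡ 1) →
                      ∃ λ t → Coprime C (D ℕ.+ t ℕ.* L)
coprime-progression C D L common-divisor≡1 with coprime-split D C
... | A , B , C≡AB , A⊥D , k , B∣Dᵏ = A , C⊥D+AL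
  where
  ∣D+AL∧∣AL⇒∣D : ∀ {f} → f ℕ.∣ D ℕ.+ A ℕ.* L → f ℕ.∣ A ℕ.* L → f ℕ.∣ D
  ∣D+AL∧∣AL⇒∣D {f} f∣D+AL = ℕ.∣m+n∣m⇒∣n (subst (f ℕ.∣_) (ℕ.+-comm D (A ℕ.* L)) f∣D+AL)
  C⊥D+AL : Coprime C (D ℕ.+ A ℕ.* L)
  C⊥D+AL {e} (e∣C , e∣D+AL) = coprime-∣^⇒≡1 k e⊥D (ℕ.∣-trans e∣B B∣Dᵏ)
    where
    e⊥A : Coprime e A
    e⊥A (f∣e , f∣A) = A⊥D (f∣A , ∣D+AL∧∣AL⇒∣D (ℕ.∣-trans f∣e e∣D+AL) (ℕ.∣m⇒∣m*n L f∣A))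
    e∣B : e ℕ.∣ B
    e∣B = coprime-divisor e⊥A (subst (e ℕ.∣_) C≡AB e∣C)
    e⊥D : Coprime e D
    e⊥D {f} (f∣e , f∣D) = common-divisor≡1 (ℕ.∣-trans f∣e e∣C) f∣D (coprime-divisor f⊥A f∣AL)
      where
      f∣AL : f ℕ.∣ A ℕ.* L
      f∣AL = ℕ.∣m+n∣m⇒∣n (ℕ.∣-trans f∣e e∣D+AL) f∣D
      f⊥A : Coprime f A
      f⊥A (h∣f , h∣A) = A⊥D (h∣A , ℕ.∣-trans h∣f f∣D)

-- Integer 2×2 matrices

mat-cong : ∀ {a b c d a' b' c' d'} → a ≡ a' → b ≡ b' → c ≡ c' → d ≡ d' → mat a b c d ≡ mat a' b' c' d'
mat-cong refl refl refl refl = refl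

·-assoc : ∀ g h k → (g · h) · k ≡ g · (h · k)
·-assoc (mat a b c d) (mat a' b' c' d') (mat a'' b'' c'' d'') =
  mat-cong (entry a b a' b' c' d' a'' c'') (entry a b a' b' c' d' b'' d'')
           (entry c d a' b' c' d' a'' c'') (entry c d a' b' c' d' b'' d'')
  where
  entry : ∀ x y a' b' c' d' x'' y'' →
          (x * a' + y * c') * x'' + (x * b' + y * d') * y'' ≡ x * (a' * x'' + b' * y'') + y * (c' * x'' + d' * y'')
  entry = solve-∀

·-identityʳ : ∀ g → g · I₂ ≡ g
·-identityʳ (mat a b c d) = mat-cong (x*1+y*0≡x a b) (x*0+y*1≡y a b) (x*1+y*0≡x c d) (x*0+y*1≡y c d)
  where
  x*1+y*0≡x : ∀ x y → x * 1ℤ + y * 0ℤ ≡ x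
  x*1+y*0≡x = solve-∀
  x*0+y*1≡y : ∀ x y → x * 0ℤ + y * 1ℤ ≡ y
  x*0+y*1≡y = solve-∀

det-· : ∀ g h → det (g · h) ≡ det g * det h
det-· (mat a b c d) (mat a' b' c' d') = expand a b c d a' b' c' d'
  where
  expand : ∀ a b c d a' b' c' d' → (a * a' + b * c') * (c * b' + d * d') - (a * b' + b * d') * (c * a' + d * c')
                                   ≡ (a * d - b * c) * (a' * d' - b' * c')
  expand = solve-∀

adj : Mat → Mat
adj (mat a b c d) = mat d (- b) (- c) a

det-adj : ∀ g → det (adj g) ≡ det g
det-adj (mat a b c d) = expand a b c d
  where
  expand : ∀ a b c d → d * a - (- b) * (- c) ≡ a * d - b * c
  expand = solve-∀

adj-inverseˡ : ∀ g → det g ≡ 1ℤ → adj g · g ≡ I₂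
adj-inverseˡ (mat a b c d) det≡1 =
  mat-cong (trans (diag a b c d) det≡1) (off b d) (off' c a) (trans (diag' a b c d) det≡1)
  where
  diag : ∀ a b c d → d * a + (- b) * c ≡ a * d - b * c
  diag = solve-∀
  diag' : ∀ a b c d → (- c) * b + a * d ≡ a * d - b * c
  diag' = solve-∀
  off : ∀ b d → d * b + (- b) * d ≡ 0ℤ
  off = solve-∀
  off' : ∀ c a → (- c) * a + a * c ≡ 0ℤ
  off' = solve-∀

·-adj-cancelʳ : ∀ g h → det h ≡ 1ℤ → (g · adj h) · h ≡ g
·-adj-cancelʳ g h det≡1 = trans (·-assoc g (adj h) h) (trans (cong (g ·_) (adj-inverseˡ h det≡1)) (·-identityʳ g))

det≡1⇒det≢0 : ∀ g → det g ≡ 1ℤ → det g ≢ 0ℤ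
det≡1⇒det≢0 g det≡1 det≡0 with trans (sym det≡1) det≡0
... | ()

-- Unimodular rows and their lifts to SL₂(ℤ)

Unimodular : ℕ → ℤ → ℤ → Set
Unimodular n c d = ∃₂ λ x y → x * c + y * d ≡ 1ℤ mod n

Unimodular-cong : ∀ {n c c' d d'} → c ≡ c' mod n → d ≡ d' mod n → Unimodular n c d → Unimodular n c' d'
Unimodular-cong {n} {c} {c'} {d} {d'} c≡c' d≡d' (x , y , xc+yd≡1) = x , y , (begin
  x * c' + y * d'  ≈⟨ +-cong-mod (*-congˡ-mod x (≡-mod-sym c≡c')) (*-congˡ-mod y (≡-mod-sym d≡d')) ⟩
  x * c + y * d    ≈⟨ xc+yd≡1 ⟩
  1ℤ               ∎)
  where open ≡-mod-Reasoning n

unimodular-common-divisor : ∀ {n c d k} → Unimodular n c d → k ℕ.∣ n → + k ∣ c → + k ∣ d → k ≡ 1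
unimodular-common-divisor (x , y , xc+yd≡1) k∣n k∣c k∣d =
  ℕ.∣1⇒≡1 (∣⇒∣ᵤ (≡-mod-resp-∣ (≡-mod-∣ k∣n xc+yd≡1) (∣m∣n⇒∣m+n (∣n⇒∣m*n x k∣c) (∣n⇒∣m*n y k∣d))))

·-reflects-Unimodular : ∀ {n u v} a b c d → Unimodular n (u * a + v * c) (u * b + v * d) → Unimodular n u v
·-reflects-Unimodular {u = u} {v} a b c d (x , y , unimodular) =
  x * a + y * b , x * c + y * d , ≡-mod-trans (≡-mod-reflexive (regroup x y u v a b c d)) unimodular
  where
  regroup : ∀ x y u v a b c d → (x * a + y * b) * u + (x * c + y * d) * v ≡ x * (u * a + v * c) + y * (u * b + v * d)
  regroup = solve-∀

det≡1⇒Unimodular : ∀ {n} g → det g ≡ 1ℤ → Unimodular n (Mat.c g) (Mat.d g)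
det≡1⇒Unimodular (mat a b c d) det≡1 = - b , a , ≡-mod-reflexive (trans (rearrange a b c d) det≡1)
  where
  rearrange : ∀ a b c d → - b * c + a * d ≡ a * d - b * c
  rearrange = solve-∀

unimodular-lift-coprime : ∀ L .{{_ : NonZero L}} {c₀ d₀} → Unimodular L c₀ d₀ →
                          ∃₂ λ C D → Coprime C D × (+ C ≡ c₀ mod L) × (+ D ≡ d₀ mod L)
unimodular-lift-coprime L {c₀} {d₀} unimodular =
  let t , C⊥D+tL = coprime-progression C D L common-divisor≡1
  in C , D ℕ.+ t ℕ.* L , C⊥D+tL , C≡c₀ , ≡-mod-trans (+-multiple-ℕ-mod L D t) D≡d₀
  where
  -- adding L keeps C ≡ c₀ but makes C nonzero
  C D : ℕ
  C = c₀ %ℕ L ℕ.+ 1 ℕ.* L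
  D = d₀ %ℕ L
  instance
    C≢0 : NonZero C
    C≢0 = ℕ.>-nonZero (ℕ.<-≤-trans (ℕ.>-nonZero⁻¹ (1 ℕ.* L) {{ℕ.m*n≢0 1 L}}) (ℕ.m≤n+m (1 ℕ.* L) (c₀ %ℕ L)))
  C≡c₀ : + C ≡ c₀ mod L
  C≡c₀ = ≡-mod-trans (+-multiple-ℕ-mod L (c₀ %ℕ L) 1) (%ℕ-≡-mod L c₀)
  D≡d₀ : + D ≡ d₀ mod L
  D≡d₀ = %ℕ-≡-mod L d₀
  common-divisor≡1 : ∀ {e} → e ℕ.∣ C → e ℕ.∣ D → e ℕ.∣ L → e ≡ 1
  common-divisor≡1 e∣C e∣D e∣L =
    unimodular-common-divisor (Unimodular-cong (≡-mod-sym C≡c₀) (≡-mod-sym D≡d₀) unimodular) e∣L (∣ᵤ⇒∣ e∣C) (∣ᵤ⇒∣ e∣D)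

coprime⇒SL₂-row : ∀ {C D} → Coprime C D → Σ Mat λ g → det g ≡ 1ℤ × Mat.c g ≡ + C × Mat.d g ≡ + D
coprime⇒SL₂-row {C} {D} C⊥D =
  let p , q , pC+qD≡1 = bézout-ℤ C⊥D
  in mat q (- p) (+ C) (+ D) , trans (expand p q (+ C) (+ D)) pC+qD≡1 , refl , refl
  where
  expand : ∀ p q C D → q * D - (- p) * C ≡ p * C + q * D
  expand = solve-∀

opaque
  SL₂-lift-row : ∀ L .{{_ : NonZero L}} {c₀ d₀} → Unimodular L c₀ d₀ →
                 Σ Mat λ g → det g ≡ 1ℤ × (Mat.c g ≡ c₀ mod L) × (Mat.d g ≡ d₀ mod L)
  SL₂-lift-row L unimodular =
    let C , D , C⊥D , C≡c₀ , D≡d₀ = unimodular-lift-coprime L unimodular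
        g , det≡1 , c≡C , d≡D = coprime⇒SL₂-row C⊥D
    in g , det≡1 , ≡-mod-trans (≡-mod-reflexive c≡C) C≡c₀ , ≡-mod-trans (≡-mod-reflexive d≡D) D≡d₀

-- The congruence subgroups Γ₁(N)

Γ₁-c : ∀ {L g} → Γ₁ L g → Mat.c g ≡ 0ℤ mod L
Γ₁-c g∈Γ₁ = ∣ᵤ⇒≡0-mod (Γ₁.c≡0 g∈Γ₁)

Γ₁-d : ∀ {L g} → Γ₁ L g → Mat.d g ≡ 1ℤ mod L
Γ₁-d g∈Γ₁ = ∣ᵤ⇒≡-mod (Γ₁.d≡1 g∈Γ₁)

Γ₁-intro : ∀ {L} g → det g ≡ 1ℤ → Mat.c g ≡ 0ℤ mod L → Mat.d g ≡ 1ℤ mod L → Γ₁ L g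
Γ₁-intro {L} (mat a b c d) det≡1 c≡0 d≡1 = record
  { det≡1 = det≡1 ; a≡1 = ≡-mod⇒∣ᵤ a≡1 ; c≡0 = ≡0-mod⇒∣ᵤ c≡0 ; d≡1 = ≡-mod⇒∣ᵤ d≡1 }
  where
  open ≡-mod-Reasoning L
  a≡1 : a ≡ 1ℤ mod L
  a≡1 = begin
    a                        ≡⟨ expand a b c ⟩
    (a * 1ℤ - b * c) + b * c ≈⟨ +-cong-mod (+-cong-mod (*-congˡ-mod a (≡-mod-sym d≡1)) ≡-mod-refl)
                                           (*-congˡ-mod b c≡0) ⟩
    (a * d - b * c) + b * 0ℤ ≡⟨ cong (λ z → z + b * 0ℤ) det≡1 ⟩
    1ℤ + b * 0ℤ              ≡⟨ simplify b ⟩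
    1ℤ                       ∎
    where
    expand : ∀ a b c → a ≡ (a * 1ℤ - b * c) + b * c
    expand = solve-∀
    simplify : ∀ b → 1ℤ + b * 0ℤ ≡ 1ℤ
    simplify = solve-∀

Γ₁-∣ : ∀ {m n g} → m ℕ.∣ n → Γ₁ n g → Γ₁ m g
Γ₁-∣ m∣n g∈Γ₁ = record
  { det≡1 = Γ₁.det≡1 g∈Γ₁
  ; a≡1 = ℕ.∣-trans m∣n (Γ₁.a≡1 g∈Γ₁)
  ; c≡0 = ℕ.∣-trans m∣n (Γ₁.c≡0 g∈Γ₁)
  ; d≡1 = ℕ.∣-trans m∣n (Γ₁.d≡1 g∈Γ₁)
  }

opaque
  unimodular-crt : ∀ {N M u v} → Coprime N M → Unimodular M u v →
                   ∃₂ λ c₀ d₀ → Unimodular (N ℕ.* M) c₀ d₀ × (c₀ ≡ 0ℤ mod N) × (d₀ ≡ 1ℤ mod N)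
                                                          × (c₀ ≡ u mod M) × (d₀ ≡ v mod M)
  unimodular-crt {N} {M} {u} {v} N⊥M (x , y , xu+yv≡1)
    with crt N⊥M 0ℤ u | crt N⊥M 1ℤ v | crt N⊥M 1ℤ y
  ... | c₀ , c₀≡0 , c₀≡u | d₀ , d₀≡1 , d₀≡v | y' , y'≡1 , y'≡y =
    c₀ , d₀ , (x , y' , ≡-mod-* N⊥M unimodular[N] unimodular[M]) , c₀≡0 , d₀≡1 , c₀≡u , d₀≡v
    where
    unimodular[N] : x * c₀ + y' * d₀ ≡ 1ℤ mod N
    unimodular[N] = begin
      x * c₀ + y' * d₀    ≈⟨ +-cong-mod (*-congˡ-mod x c₀≡0) (*-cong-mod y'≡1 d₀≡1) ⟩
      x * 0ℤ + 1ℤ * 1ℤ    ≡⟨ simplify x ⟩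
      1ℤ                  ∎
      where
      open ≡-mod-Reasoning N
      simplify : ∀ x → x * 0ℤ + 1ℤ * 1ℤ ≡ 1ℤ
      simplify = solve-∀
    unimodular[M] : x * c₀ + y' * d₀ ≡ 1ℤ mod M
    unimodular[M] = begin
      x * c₀ + y' * d₀    ≈⟨ +-cong-mod (*-congˡ-mod x c₀≡u) (*-cong-mod y'≡y d₀≡v) ⟩
      x * u + y * v       ≈⟨ xu+yv≡1 ⟩
      1ℤ                  ∎
      where open ≡-mod-Reasoning M

opaque
  Γ₁-lift : ∀ {N M} .{{_ : NonZero N}} .{{_ : NonZero M}} {u v} → Coprime N M → Unimodular M u v →
            Σ Mat λ g → Γ₁ N g × (Mat.c g ≡ u mod M) × (Mat.d g ≡ v mod M)
  Γ₁-lift {N} {M} N⊥M unimodular with unimodular-crt N⊥M unimodular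
  ... | c₀ , d₀ , unimodular₀ , c₀≡0 , d₀≡1 , c₀≡u , d₀≡v
    with SL₂-lift-row (N ℕ.* M) {{ℕ.m*n≢0 N M}} unimodular₀
  ... | g , det≡1 , c≡c₀ , d≡d₀ =
    g , Γ₁-intro g det≡1 (≡-mod-trans (mod-N c≡c₀) c₀≡0) (≡-mod-trans (mod-N d≡d₀) d₀≡1)
      , ≡-mod-trans (mod-M c≡c₀) c₀≡u
      , ≡-mod-trans (mod-M d≡d₀) d₀≡v
    where
    mod-N : ∀ {a b} → a ≡ b mod N ℕ.* M → a ≡ b mod N
    mod-N = ≡-mod-∣ (ℕ.m∣m*n M)
    mod-M : ∀ {a b} → a ≡ b mod N ℕ.* M → a ≡ b mod M
    mod-M = ≡-mod-∣ (ℕ.n∣m*n N)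

·-adj-bottom-row : ∀ {L g g'} → det g ≡ 1ℤ → Mat.c g' ≡ Mat.c g mod L → Mat.d g' ≡ Mat.d g mod L →
                   (Mat.c (g' · adj g) ≡ 0ℤ mod L) × (Mat.d (g' · adj g) ≡ 1ℤ mod L)
·-adj-bottom-row {L} {mat a b c d} {mat a' b' c' d'} det≡1 c'≡c d'≡d = c-entry , d-entry
  where
  open ≡-mod-Reasoning L
  c-entry : c' * d + d' * (- c) ≡ 0ℤ mod L
  c-entry = begin
    c' * d + d' * (- c)  ≈⟨ +-cong-mod (*-cong-mod c'≡c ≡-mod-refl) (*-cong-mod d'≡d ≡-mod-refl) ⟩
    c * d + d * (- c)    ≡⟨ cancel c d ⟩
    0ℤ                   ∎
    where
    cancel : ∀ c d → c * d + d * (- c) ≡ 0ℤ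
    cancel = solve-∀
  d-entry : c' * (- b) + d' * a ≡ 1ℤ mod L
  d-entry = begin
    c' * (- b) + d' * a  ≈⟨ +-cong-mod (*-cong-mod c'≡c ≡-mod-refl) (*-cong-mod d'≡d ≡-mod-refl) ⟩
    c * (- b) + d * a    ≡⟨ rearrange a b c d ⟩
    a * d - b * c        ≡⟨ det≡1 ⟩
    1ℤ                   ∎
    where
    rearrange : ∀ a b c d → c * (- b) + d * a ≡ a * d - b * c
    rearrange = solve-∀

Γ₁-quotient : ∀ {N M g g'} → Coprime N M → Γ₁ N g → Γ₁ N g' →
              Mat.c g' ≡ Mat.c g mod M → Mat.d g' ≡ Mat.d g mod M → Γ₁ (N ℕ.* M) (g' · adj g)
Γ₁-quotient {N} {M} {g} {g'} N⊥M g∈Γ₁ g'∈Γ₁ c'≡c[M] d'≡d[M] =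
  let c≡0[N] , d≡1[N] = ·-adj-bottom-row {N} {g} {g'} (Γ₁.det≡1 g∈Γ₁)
                          (≡-mod-trans (Γ₁-c g'∈Γ₁) (≡-mod-sym (Γ₁-c g∈Γ₁)))
                          (≡-mod-trans (Γ₁-d g'∈Γ₁) (≡-mod-sym (Γ₁-d g∈Γ₁)))
      c≡0[M] , d≡1[M] = ·-adj-bottom-row {M} {g} {g'} (Γ₁.det≡1 g∈Γ₁) c'≡c[M] d'≡d[M]
  in Γ₁-intro (g' · adj g) det≡1 (≡-mod-* N⊥M c≡0[N] c≡0[M]) (≡-mod-* N⊥M d≡1[N] d≡1[M])
  where
  det≡1 : det (g' · adj g) ≡ 1ℤ
  det≡1 = trans (det-· g' (adj g)) (cong₂ _*_ (Γ₁.det≡1 g'∈Γ₁) (trans (det-adj g) (Γ₁.det≡1 g∈Γ₁)))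

-- Row vectors modulo M

module _ (M : ℕ) .{{_ : NonZero M}} where

  reduce-≡-mod : ∀ z → + toℕ (reduce M z) ≡ z mod M
  reduce-≡-mod z = subst (λ r → + r ≡ z mod M) (sym (toℕ-fromℕ< _)) (%ℕ-≡-mod M z)

  reduce-cong : ∀ {x y} → x ≡ y mod M → reduce M x ≡ reduce M y
  reduce-cong {x} {y} x≡y = toℕ-injective (residue-unique (toℕ<n (reduce M x)) (toℕ<n (reduce M y))
    (≡-mod-trans (reduce-≡-mod x) (≡-mod-trans x≡y (≡-mod-sym (reduce-≡-mod y)))))

  reduce-injective : ∀ {x y} → reduce M x ≡ reduce M y → x ≡ y mod M
  reduce-injective {x} {y} eq =
    ≡-mod-trans (≡-mod-sym (reduce-≡-mod x)) (≡-mod-trans (≡-mod-reflexive (cong (λ i → + toℕ i) eq)) (reduce-≡-mod y))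

  reduce-toℕ : ∀ i → reduce M (+ toℕ i) ≡ i
  reduce-toℕ i = toℕ-injective (residue-unique (toℕ<n (reduce M (+ toℕ i))) (toℕ<n i) (reduce-≡-mod (+ toℕ i)))

  rowMul-e₂ : ∀ g → rowMul M (e₂ M) g ≡ (reduce M (Mat.c g) , reduce M (Mat.d g))
  rowMul-e₂ (mat a b c d) = cong₂ _,_ (reduce-cong (entry a c)) (reduce-cong (entry b d))
    where
    open ≡-mod-Reasoning M
    entry : ∀ x y → + toℕ (reduce M 0ℤ) * x + + toℕ (reduce M 1ℤ) * y ≡ y mod M
    entry x y = begin
      + toℕ (reduce M 0ℤ) * x + + toℕ (reduce M 1ℤ) * y
        ≈⟨ +-cong-mod (*-cong-mod (reduce-≡-mod 0ℤ) ≡-mod-refl) (*-cong-mod (reduce-≡-mod 1ℤ) ≡-mod-refl) ⟩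
      0ℤ * x + 1ℤ * y  ≡⟨ simplify x y ⟩
      y                ∎
      where
      simplify : ∀ x y → 0ℤ * x + 1ℤ * y ≡ y
      simplify = solve-∀

  rowMul-· : ∀ x g h → rowMul M (rowMul M x g) h ≡ rowMul M x (g · h)
  rowMul-· (u , v) (mat a b c d) (mat a' b' c' d') = cong₂ _,_ (reduce-cong (entry a' c')) (reduce-cong (entry b' d'))
    where
    open ≡-mod-Reasoning M
    U V : ℤ
    U = + toℕ u
    V = + toℕ v
    entry : ∀ x y → + toℕ (reduce M (U * a + V * c)) * x + + toℕ (reduce M (U * b + V * d)) * y
                    ≡ U * (a * x + b * y) + V * (c * x + d * y) mod M
    entry x y = begin
      + toℕ (reduce M (U * a + V * c)) * x + + toℕ (reduce M (U * b + V * d)) * y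
        ≈⟨ +-cong-mod (*-cong-mod (reduce-≡-mod (U * a + V * c)) ≡-mod-refl)
                      (*-cong-mod (reduce-≡-mod (U * b + V * d)) ≡-mod-refl) ⟩
      (U * a + V * c) * x + (U * b + V * d) * y  ≡⟨ regroup U V a b c d x y ⟩
      U * (a * x + b * y) + V * (c * x + d * y)  ∎
      where
      regroup : ∀ U V a b c d x y →
                (U * a + V * c) * x + (U * b + V * d) * y ≡ U * (a * x + b * y) + V * (c * x + d * y)
      regroup = solve-∀

  Generates⇒Unimodular : ∀ {u v} → Generates M (u , v) → Unimodular M (+ toℕ u) (+ toℕ v)
  Generates⇒Unimodular (x , y , M∣xu+yv-1) = x , y , ∣ᵤ⇒≡-mod M∣xu+yv-1

  Unimodular⇒Generates : ∀ {u v} → Unimodular M (+ toℕ u) (+ toℕ v) → Generates M (u , v)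
  Unimodular⇒Generates (x , y , xu+yv≡1) = x , y , ≡-mod⇒∣ᵤ xu+yv≡1

  Generates-reduce⁺ : ∀ {c d} → Unimodular M c d → Generates M (reduce M c , reduce M d)
  Generates-reduce⁺ {c} {d} =
    Unimodular⇒Generates ∘ Unimodular-cong (≡-mod-sym (reduce-≡-mod c)) (≡-mod-sym (reduce-≡-mod d))

  Generates-reduce⁻ : ∀ {c d} → Generates M (reduce M c , reduce M d) → Unimodular M c d
  Generates-reduce⁻ {c} {d} = Unimodular-cong (reduce-≡-mod c) (reduce-≡-mod d) ∘ Generates⇒Unimodular

  generates? : ∀ x → Dec (Generates M x)
  generates? (u , v) = map′ (λ (i , j , p) → + toℕ i , + toℕ j , p) residues
    (any? λ i → any? λ j → M ℕ.∣? ∣ + toℕ i * + toℕ u + + toℕ j * + toℕ v - 1ℤ ∣)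
    where
    residues : Generates M (u , v) → ∃₂ λ (i j : Fin M) → + M ℤᵘ.∣ + toℕ i * + toℕ u + + toℕ j * + toℕ v - 1ℤ
    residues (x , y , p) = reduce M x , reduce M y , ≡-mod⇒∣ᵤ (≡-mod-trans
      (+-cong-mod (*-cong-mod (reduce-≡-mod x) ≡-mod-refl) (*-cong-mod (reduce-≡-mod y) ≡-mod-refl)) (∣ᵤ⇒≡-mod p))

  rowMul-reflects-Generates : ∀ x h → Generates M (rowMul M x h) → Generates M x
  rowMul-reflects-Generates (u , v) (mat a b c d) =
    Unimodular⇒Generates ∘ ·-reflects-Unimodular a b c d ∘ Generates-reduce⁻

  det≡1⇒Generates-e₂-row : ∀ g → det g ≡ 1ℤ → Generates M (rowMul M (e₂ M) g)
  det≡1⇒Generates-e₂-row g det≡1 =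
    subst (Generates M) (sym (rowMul-e₂ g)) (Generates-reduce⁺ (det≡1⇒Unimodular g det≡1))

  Γ₁-fixes-e₂ : ∀ {k} → Γ₁ M k → rowMul M (e₂ M) k ≡ e₂ M
  Γ₁-fixes-e₂ {k} k∈Γ₁ = trans (rowMul-e₂ k) (cong₂ _,_ (reduce-cong (Γ₁-c k∈Γ₁)) (reduce-cong (Γ₁-d k∈Γ₁)))

  opaque
    Γ₁-lift-e₂ : ∀ {N} .{{_ : NonZero N}} {x} → Coprime N M → Generates M x →
                  Σ Mat λ g → Γ₁ N g × rowMul M (e₂ M) g ≡ x
    Γ₁-lift-e₂ {x = u , v} N⊥M generates with Γ₁-lift N⊥M (Generates⇒Unimodular generates)
    ... | g , g∈Γ₁ , c≡u , d≡v = g , g∈Γ₁ , trans (rowMul-e₂ g)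
      (cong₂ _,_ (trans (reduce-cong c≡u) (reduce-toℕ u)) (trans (reduce-cong d≡v) (reduce-toℕ v)))

  Γ₁-quotient-e₂ : ∀ {N g g'} → Coprime N M → Γ₁ N g → Γ₁ N g' →
                    rowMul M (e₂ M) g' ≡ rowMul M (e₂ M) g → Γ₁ (N ℕ.* M) (g' · adj g)
  Γ₁-quotient-e₂ {g = g} {g'} N⊥M g∈Γ₁ g'∈Γ₁ same-row =
    Γ₁-quotient N⊥M g∈Γ₁ g'∈Γ₁ (reduce-injective (cong proj₁ bottom-rows))
                               (reduce-injective (cong proj₂ bottom-rows))
    where
    bottom-rows : (reduce M (Mat.c g') , reduce M (Mat.d g')) ≡ (reduce M (Mat.c g) , reduce M (Mat.d g))
    bottom-rows = trans (sym (rowMul-e₂ g')) (trans same-row (rowMul-e₂ g))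

-- The map Φ

module _ {r ℓr m ℓm : Level} {R : Ring r ℓr} {V : LeftModule R m ℓm} (A : MatAction R V) where
  open Ring R using (0#)
  open LeftModule V
  open MatAction A
  open SetoidReasoning ≈ᴹ-setoid

  act-0ᴹ : ∀ g .(p : det g ≢ 0ℤ) → act g p 0ᴹ ≈ᴹ 0ᴹ
  act-0ᴹ g p = begin
    act g p 0ᴹ           ≈⟨ act-cong g p (*ₗ-zeroˡ 0ᴹ) ⟨
    act g p (0# *ₗ 0ᴹ)   ≈⟨ act-*ₗ g p 0# 0ᴹ ⟩
    0# *ₗ act g p 0ᴹ     ≈⟨ *ₗ-zeroˡ (act g p 0ᴹ) ⟩
    0ᴹ                   ∎

  act-≡ : ∀ {g h} → g ≡ h → .(p : det g ≢ 0ℤ) .(q : det h ≢ 0ℤ) → ∀ z → act g p z ≈ᴹ act h q z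
  act-≡ refl p q z = ≈ᴹ-refl

  act-adj-act : ∀ g (det≡1 : det g ≡ 1ℤ) z →
                act (adj g) (det≡1⇒det≢0 (adj g) (trans (det-adj g) det≡1)) (act g (det≡1⇒det≢0 g det≡1) z) ≈ᴹ z
  act-adj-act g det≡1 z = begin
    act (adj g) _ (act g _ z)  ≈⟨ act-· (adj g) g _ _ (det≡1⇒det≢0 (adj g · g) (cong det (adj-inverseˡ g det≡1))) z ⟨
    act (adj g · g) _ z        ≈⟨ act-≡ (adj-inverseˡ g det≡1) _ (det≡1⇒det≢0 I₂ refl) z ⟩
    act I₂ _ z                 ≈⟨ act-I _ z ⟩
    z                          ∎

  module _ (N M : ℕ) .{{_ : NonZero M}} where
    open Construction A N M

    InW-actW : ∀ h .(h∈Γ₁ : Γ₁ N h) f → InW f → InW (actW h h∈Γ₁ f)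
    InW-actW h h∈Γ₁ f f∈W x ¬gen = begin
      act h _ (f (rowMul M x h))  ≈⟨ act-cong h _ (f∈W (rowMul M x h) (¬gen ∘ rowMul-reflects-Generates M x h)) ⟩
      act h (Γ₁⇒det≢0 h∈Γ₁) 0ᴹ    ≈⟨ act-0ᴹ h _ ⟩
      0ᴹ                          ∎

    Φ-InCoind : ∀ f → InCoind (Φ f)
    Φ-InCoind f k g k∈Γ₁ g∈Γ₁ kg∈Γ₁ = begin
      act (k · g) _ (f (rowMul M (e₂ M) (k · g)))  ≡⟨ cong (λ y → act (k · g) (Γ₁⇒det≢0 kg∈Γ₁) (f y)) same-row ⟩
      act (k · g) _ (f (rowMul M (e₂ M) g))        ≈⟨ act-· k g _ _ _ _ ⟩
      act k _ (act g _ (f (rowMul M (e₂ M) g)))    ∎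
      where
      k-fixes-e₂ : rowMul M (e₂ M) k ≡ e₂ M
      k-fixes-e₂ = recompute (≡-dec _≟_ _≟_ _ _) (Γ₁-fixes-e₂ M (Γ₁-∣ (ℕ.n∣m*n N) k∈Γ₁))
      same-row : rowMul M (e₂ M) (k · g) ≡ rowMul M (e₂ M) g
      same-row = trans (sym (rowMul-· M (e₂ M) k g)) (cong (λ y → rowMul M y g) k-fixes-e₂)

    Φ-cong : ∀ f f' → (∀ x → f x ≈ᴹ f' x) → Φ f ≈C Φ f'
    Φ-cong f f' f≈f' g g∈Γ₁ = act-cong g _ (f≈f' _)

    Φ-+ᴹ : ∀ f f' → Φ (λ x → f x +ᴹ f' x) ≈C (λ g g∈Γ₁ → Φ f g g∈Γ₁ +ᴹ Φ f' g g∈Γ₁)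
    Φ-+ᴹ f f' g g∈Γ₁ = act-+ g _ _ _

    Φ-*ₗ : ∀ s f → Φ (λ x → s *ₗ f x) ≈C (λ g g∈Γ₁ → s *ₗ Φ f g g∈Γ₁)
    Φ-*ₗ s f g g∈Γ₁ = act-*ₗ g _ s _

    Φ-actW : ∀ h g .(h∈Γ₁ : Γ₁ N h) .(g∈Γ₁ : Γ₁ N g) .(gh∈Γ₁ : Γ₁ N (g · h)) f →
             Φ (actW h h∈Γ₁ f) g g∈Γ₁ ≈ᴹ Φ f (g · h) gh∈Γ₁
    Φ-actW h g h∈Γ₁ g∈Γ₁ gh∈Γ₁ f = begin
      act g _ (act h _ (f (rowMul M (rowMul M (e₂ M) g) h)))  ≈⟨ act-· g h _ _ (Γ₁⇒det≢0 gh∈Γ₁) _ ⟨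
      act (g · h) _ (f (rowMul M (rowMul M (e₂ M) g) h))
        ≡⟨ cong (λ y → act (g · h) (Γ₁⇒det≢0 gh∈Γ₁) (f y)) (rowMul-· M (e₂ M) g h) ⟩
      act (g · h) _ (f (rowMul M (e₂ M) (g · h)))             ∎

    module _ .{{_ : NonZero N}} (N⊥M : Coprime N M) where

      Φ-injective : ∀ f f' → InW f → InW f' → Φ f ≈C Φ f' → ∀ x → f x ≈ᴹ f' x
      Φ-injective f f' f∈W f'∈W Φf≈Φf' x with generates? M x
      ... | no ¬gen = ≈ᴹ-trans (f∈W x ¬gen) (≈ᴹ-sym (f'∈W x ¬gen))
      ... | yes gen with Γ₁-lift-e₂ M N⊥M gen
      ...   | g , g∈Γ₁ , refl = begin
        f (rowMul M (e₂ M) g)         ≈⟨ act-adj-act g det≡1 _ ⟨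
        act (adj g) _ (Φ f g g∈Γ₁)    ≈⟨ act-cong (adj g) _ (Φf≈Φf' g g∈Γ₁) ⟩
        act (adj g) _ (Φ f' g g∈Γ₁)   ≈⟨ act-adj-act g det≡1 _ ⟩
        f' (rowMul M (e₂ M) g)        ∎
        where
        det≡1 : det g ≡ 1ℤ
        det≡1 = Γ₁.det≡1 g∈Γ₁

      Φ-surjective : ∀ φ → InCoind φ → Σ (Pair M → Carrierᴹ) (λ f → InW f × (Φ f ≈C φ))
      Φ-surjective φ φ∈Coind = f , f∈W , Φf≈φ
        where
        RowLift : Pair M → Set
        RowLift x = Σ Mat λ g → Γ₁ N g × rowMul M (e₂ M) g ≡ x
        pull : ∀ {x} → RowLift x → Carrierᴹ
        pull (g , g∈Γ₁ , _) = act (adj g) (det≡1⇒det≢0 (adj g) (trans (det-adj g) (Γ₁.det≡1 g∈Γ₁))) (φ g g∈Γ₁)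
        f-at : ∀ x → Dec (Generates M x) → Carrierᴹ
        f-at _ (yes gen) = pull (Γ₁-lift-e₂ M N⊥M gen)
        f-at _ (no _)    = 0ᴹ
        f : Pair M → Carrierᴹ
        f x = f-at x (generates? M x)
        f∈W : InW f
        f∈W x ¬gen with generates? M x
        ... | yes gen = ⊥-elim (¬gen gen)
        ... | no _    = ≈ᴹ-refl
        φ-≡ : ∀ {g h} → g ≡ h → .(g∈Γ₁ : Γ₁ N g) .(h∈Γ₁ : Γ₁ N h) → φ g g∈Γ₁ ≈ᴹ φ h h∈Γ₁
        φ-≡ refl _ _ = ≈ᴹ-refl
        pull-coherent : ∀ g .(g∈Γ₁ : Γ₁ N g) (lift : RowLift (rowMul M (e₂ M) g)) →
                        act g (Γ₁⇒det≢0 g∈Γ₁) (pull lift) ≈ᴹ φ g g∈Γ₁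
        pull-coherent g g∈Γ₁ (g' , g'∈Γ₁ , same-row) = begin
          act g _ (act (adj g') _ (φ g' g'∈Γ₁))
            ≈⟨ act-· g (adj g') _ _ (Γ₁⇒det≢0 (Γ₁-∣ (ℕ.m∣m*n {N} M) (k∈Γ₁ g∈Γ₁))) _ ⟨
          act (g · adj g') _ (φ g' g'∈Γ₁)
            ≈⟨ φ∈Coind (g · adj g') g' (k∈Γ₁ g∈Γ₁) g'∈Γ₁ (subst (Γ₁ N) (sym kg'≡g) g∈Γ₁) ⟨
          φ ((g · adj g') · g') _                ≈⟨ φ-≡ kg'≡g _ _ ⟩
          φ g g∈Γ₁                               ∎
          where
          kg'≡g : (g · adj g') · g' ≡ g
          kg'≡g = ·-adj-cancelʳ g g' (Γ₁.det≡1 g'∈Γ₁)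
          k∈Γ₁ : Γ₁ N g → Γ₁ (N ℕ.* M) (g · adj g')
          k∈Γ₁ g∈Γ₁ = Γ₁-quotient-e₂ M N⊥M g'∈Γ₁ g∈Γ₁ (sym same-row)
        Φf≈φ : Φ f ≈C φ
        Φf≈φ g g∈Γ₁ with generates? M (rowMul M (e₂ M) g)
        ... | no ¬gen = ⊥-elim-irr (¬gen (det≡1⇒Generates-e₂-row M g (Γ₁.det≡1 g∈Γ₁)))
        ... | yes gen = pull-coherent g g∈Γ₁ (Γ₁-lift-e₂ M N⊥M gen)

lemma3p2 : ∀ {r ℓr m ℓm : Level} (R : Ring r ℓr) (V : LeftModule R m ℓm)
           (A : MatAction R V) (N M : ℕ) .{{_ : ℕ.NonZero N}} .{{_ : ℕ.NonZero M}} →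
           Coprime N M →
           let open LeftModule V
               open Construction A N M
           in
           -- 𝒲(M,V) is stable under the restricted Γ₁(N)-action
           (∀ h .(ph : Γ₁ N h) f → InW f → InW (actW h ph f))
           -- the map is well defined: lands in the coinduced module
           × (∀ f → InW f → InCoind (Φ f))
           -- it respects equality
           × (∀ f f' → (∀ x → f x ≈ᴹ f' x) → Φ f ≈C Φ f')
           -- it is R-linear
           × (∀ f f' → Φ (λ x → f x +ᴹ f' x) ≈C (λ g pg → Φ f g pg +ᴹ Φ f' g pg))
           × (∀ s f → Φ (λ x → s *ₗ f x) ≈C (λ g pg → s *ₗ Φ f g pg))
           -- it is Γ₁(N)-equivariant: Φ(h.f)(g) = (h.Φ f)(g) = Φ f (g h)
           × (∀ h g .(ph : Γ₁ N h) .(pg : Γ₁ N g) .(pgh : Γ₁ N (g · h)) f →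
                Φ (actW h ph f) g pg ≈ᴹ Φ f (g · h) pgh)
           -- it is injective
           × (∀ f f' → InW f → InW f' → Φ f ≈C Φ f' → ∀ x → f x ≈ᴹ f' x)
           -- it is surjective
           × (∀ φ → InCoind φ → Σ (Pair M → Carrierᴹ) (λ f → InW f × (Φ f ≈C φ)))
lemma3p2 R V A N M N⊥M =
    InW-actW A N M
  , (λ f _ → Φ-InCoind A N M f)
  , Φ-cong A N M
  , Φ-+ᴹ A N M
  , Φ-*ₗ A N M
  , Φ-actW A N M
  , Φ-injective A N M N⊥M
  , Φ-surjective A N M N⊥M
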